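{- For any graph $G$, $\chi_{\mathrm{gp}}(G)\ge \left\lceil\frac{\operatorname{diam}^*(G)+1}{2}\right\rceil$, where $\operatorname{diam}^*(G)$ is the maximum of the diameters of the components of $G$. Likewise $\chi_{\mathrm{mp}}(G)\ge \left\lceil\frac{\operatorname{diam}_m^*(G)+1}{2}\right\rceil$, where $\operatorname{diam}_m^*(G)$ is the maximum over components of the monophonic diameter.
   Context: A set $S$ is in general position (resp. monophonic position) if no shortest path (resp. induced path) of the graph contains more than two vertices of $S$; for disconnected graphs this is required within each component. $\chi_{\mathrm{gp}}(G)$ (resp. $\chi_{\mathrm{mp}}(G)$) is the minimum number of colours in a colouring of $V(G)$ where each colour class is in general (resp. monophonic) position. The monophonic diameter of a connected graph is the length of a longest induced path. -}

module Defs where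

open import Data.Nat using (ℕ; suc; _≤_; _<_)
open import Data.Fin using (Fin; zero; suc; inject₁; fromℕ; toℕ)
open import Data.Product using (Σ; _×_; ∃; ∃-syntax; _,_)
open import Data.Sum using (_⊎_)
open import Data.Empty using (⊥)
open import Relation.Nullary using (¬_)
open import Relation.Binary.PropositionalEquality using (_≡_)
open import Function.Definitions using (Injective)

record Graph : Set₁ where
  field
    n      : ℕ
    Adj    : Fin n → Fin n → Set
    symm   : ∀ {u v} → Adj u v → Adj v u
    irrefl : ∀ {u} → ¬ Adj u u

module _ (G : Graph) where
  open Graph G

  V : Set
  V = Fin n

  IsWalk : (L : ℕ) → (Fin (suc L) → V) → Set
  IsWalk L w = ∀ (i : Fin L) → Adj (w (inject₁ i)) (w (suc i))

  IsPath : (L : ℕ) → (Fin (suc L) → V) → Set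
  IsPath L p = IsWalk L p × Injective _≡_ _≡_ p

  IsShortestPath : (L : ℕ) → (Fin (suc L) → V) → Set
  IsShortestPath L p =
    IsPath L p ×
    (∀ (L' : ℕ) (w : Fin (suc L') → V) → IsWalk L' w →
       w zero ≡ p zero → w (fromℕ L') ≡ p (fromℕ L) → L ≤ L')

  IsInducedPath : (L : ℕ) → (Fin (suc L) → V) → Set
  IsInducedPath L p =
    IsPath L p ×
    (∀ (i j : Fin (suc L)) → Adj (p i) (p j) →
       toℕ i ≡ suc (toℕ j) ⊎ toℕ j ≡ suc (toℕ i))

  -- A path contains more than two vertices of S (the path is injective, so
  -- three distinct positions give three distinct vertices).
  HasThreeIn : (S : V → Set) (L : ℕ) → (Fin (suc L) → V) → Set
  HasThreeIn S L p = Σ (Fin (suc L)) λ i → Σ (Fin (suc L)) λ j → Σ (Fin (suc L)) λ k →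
    (toℕ i < toℕ j) × (toℕ j < toℕ k) × S (p i) × S (p j) × S (p k)

  -- General position / monophonic position (within components automatically,
  -- since every path lies in a single component).
  InGeneralPosition : (V → Set) → Set
  InGeneralPosition S = ∀ (L : ℕ) (p : Fin (suc L) → V) → IsShortestPath L p → ¬ HasThreeIn S L p

  InMonophonicPosition : (V → Set) → Set
  InMonophonicPosition S = ∀ (L : ℕ) (p : Fin (suc L) → V) → IsInducedPath L p → ¬ HasThreeIn S L p

  GPColouring : ℕ → Set
  GPColouring k = Σ (V → Fin k) λ c → ∀ (a : Fin k) → InGeneralPosition (λ x → c x ≡ a)

  MPColouring : ℕ → Set
  MPColouring k = Σ (V → Fin k) λ c → ∀ (a : Fin k) → InMonophonicPosition (λ x → c x ≡ a)

  IsChiGP : ℕ → Set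
  IsChiGP χ = GPColouring χ × (∀ k → GPColouring k → χ ≤ k)

  IsChiMP : ℕ → Set
  IsChiMP χ = MPColouring χ × (∀ k → MPColouring k → χ ≤ k)

  IsDist : V → V → ℕ → Set
  IsDist u v d =
    (Σ (Fin (suc d) → V) λ w → IsWalk d w × w zero ≡ u × w (fromℕ d) ≡ v) ×
    (∀ (L : ℕ) (w : Fin (suc L) → V) → IsWalk L w → w zero ≡ u → w (fromℕ L) ≡ v → d ≤ L)

  -- diam*(G): maximum of the diameters of the components, i.e. the maximum
  -- distance between two vertices lying in a common component.
  IsDiamStar : ℕ → Set
  IsDiamStar D =
    (Σ V λ u → Σ V λ v → IsDist u v D) ×
    (∀ (u v : V) (d : ℕ) → IsDist u v d → d ≤ D)

  -- diam*_m(G): maximum over components of the monophonic diameter (length of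
  -- a longest induced path); every induced path lies in one component.
  IsMonoDiamStar : ℕ → Set
  IsMonoDiamStar D =
    (Σ (Fin (suc D) → V) λ p → IsInducedPath D p) ×
    (∀ (L : ℕ) (p : Fin (suc L) → V) → IsInducedPath L p → L ≤ D)

-- A shortest path (for χ_gp) and an induced path (for χ_mp) of length D have
-- D + 1 vertices, and a colour class in general (monophonic) position meets such
-- a path in at most two vertices, so D + 1 ≤ 2χ. For the general-position bound
-- the path is a walk realising diam*(G): it has no repeated vertex, since cutting
-- out the closed subwalk between two occurrences would give a shorter walk.
module Submission where

open import Defs
open import Data.Nat using (ℕ; zero; suc; _+_; _≤_; _<_; _<?_; _≤?_; z≤n; z<s; ⌈_/2⌉)
open import Data.Nat.Properties as ℕ
  using (≤-refl; ≤-reflexive; <⇒≤; <⇒≱; ≤-<-trans; m≤m+n; m<m+n; n<1+n; m<n⇒m<1+n;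
         +-monoˡ-<; +-identityʳ; m≤n⇒∃[o]m+o≡n; ⌈n/2⌉-mono; n≡⌈n+n/2⌉;
         +-commutativeSemigroup)
open import Algebra.Properties.CommutativeSemigroup +-commutativeSemigroup using (xy∙z≈xz∙y)
open import Data.Fin as Fin using (Fin; toℕ; fromℕ; fromℕ<; inject₁; join)
open import Data.Fin.Properties
  using (toℕ-fromℕ; toℕ-fromℕ<; fromℕ<-toℕ; toℕ-inject₁; toℕ<n; toℕ≤pred[n];
         <-cmp; any?; splitAt-join; injective⇒≤)
  renaming (_≟_ to _≟ᶠ_)
open import Data.Product using (Σ; ∃; _×_; _,_)
open import Data.Sum using (_⊎_; inj₁; inj₂)
open import Data.Sum.Properties using (inj₁-injective; inj₂-injective)
open import Data.Empty using (⊥; ⊥-elim)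
open import Function using (_∘_)
open import Function.Definitions using (Injective)
open import Relation.Nullary using (¬_; Dec; yes; no)
open import Relation.Nullary.Decidable using (_×-dec_)
open import Relation.Binary.Definitions using (tri<; tri≈; tri>)
open import Relation.Binary.PropositionalEquality
  using (_≡_; refl; sym; trans; cong; subst; subst₂; module ≡-Reasoning)

AtMostTwoToOne : ∀ {m k} → (Fin m → Fin k) → Set
AtMostTwoToOne f = ∀ {i j l} → i Fin.< j → j Fin.< l → f i ≡ f j → f j ≡ f l → ⊥

join-injective : ∀ {m n} → Injective _≡_ _≡_ (join m n)
join-injective {m} {n} {x} {y} eq = begin
  x                        ≡⟨ splitAt-join m n x ⟨
  Fin.splitAt m (join m n x) ≡⟨ cong (Fin.splitAt m) eq ⟩
  Fin.splitAt m (join m n y) ≡⟨ splitAt-join m n y ⟩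
  y                        ∎
  where open ≡-Reasoning

<-distinct⇒injective : ∀ {n} {A : Set} (f : Fin n → A) →
                       (∀ {i j} → i Fin.< j → f i ≡ f j → ⊥) → Injective _≡_ _≡_ f
<-distinct⇒injective f distinct {i} {j} eq with <-cmp i j
... | tri< i<j _ _ = ⊥-elim (distinct i<j eq)
... | tri≈ _ i≡j _ = i≡j
... | tri> _ _ j<i = ⊥-elim (distinct j<i (sym eq))

module _ {m k} (f : Fin m → Fin k) (twoToOne : AtMostTwoToOne f) where

  private
    OccursBefore : Fin m → Set
    OccursBefore i = ∃ λ j → j Fin.< i × f j ≡ f i

    occursBefore? : ∀ i → Dec (OccursBefore i)
    occursBefore? i = any? (λ j → (toℕ j <? toℕ i) ×-dec (f j ≟ᶠ f i))

    -- The first and the second occurrence of a colour are sent to different copies of Fin k.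
    tag : ∀ i → Dec (OccursBefore i) → Fin k ⊎ Fin k
    tag i (no _)  = inj₁ (f i)
    tag i (yes _) = inj₂ (f i)

    tag-<-distinct : ∀ {i j} → i Fin.< j → ∀ di dj → tag i di ≡ tag j dj → ⊥
    tag-<-distinct i<j (no _) (no ¬before) eq = ¬before (_ , i<j , inj₁-injective eq)
    tag-<-distinct i<j (yes (l , l<i , fl≡fi)) (yes _) eq = twoToOne l<i i<j fl≡fi (inj₂-injective eq)
    tag-<-distinct i<j (no _)  (yes _) ()
    tag-<-distinct i<j (yes _) (no _)  ()

    label : Fin m → Fin (k + k)
    label i = join k k (tag i (occursBefore? i))

    label-injective : Injective _≡_ _≡_ label
    label-injective = <-distinct⇒injective label
      (λ {i} {j} i<j → tag-<-distinct i<j (occursBefore? i) (occursBefore? j) ∘ join-injective)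

  atMostTwoToOne⇒≤+ : m ≤ k + k
  atMostTwoToOne⇒≤+ = injective⇒≤ label-injective

  atMostTwoToOne⇒⌈/2⌉≤ : ⌈ m /2⌉ ≤ k
  atMostTwoToOne⇒⌈/2⌉≤ = subst (⌈ m /2⌉ ≤_) (sym (n≡⌈n+n/2⌉ k)) (⌈n/2⌉-mono atMostTwoToOne⇒≤+)

module _ (G : Graph) where
  open Graph G

  -- Walks are reindexed by ℕ so that cutting out a closed subwalk needs no Fin arithmetic.
  IsWalkℕ : ℕ → (ℕ → V G) → Set
  IsWalkℕ L g = ∀ k → k < L → Adj (g k) (g (suc k))

  extend : ∀ {L} → (Fin (suc L) → V G) → ℕ → V G
  extend {L} w k with k <? suc L
  ... | yes k≤L = w (fromℕ< k≤L)
  ... | no _    = w (fromℕ L)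

  extend-toℕ : ∀ {L} (w : Fin (suc L) → V G) (t : Fin (suc L)) → extend w (toℕ t) ≡ w t
  extend-toℕ {L} w t with toℕ t <? suc L
  ... | yes t≤L = cong w (fromℕ<-toℕ t t≤L)
  ... | no t≰L  = ⊥-elim (t≰L (toℕ<n t))

  extend-fromℕ : ∀ {L} (w : Fin (suc L) → V G) → extend w L ≡ w (fromℕ L)
  extend-fromℕ {L} w = trans (cong (extend w) (sym (toℕ-fromℕ L))) (extend-toℕ w (fromℕ L))

  walk⇒walkℕ : ∀ {L w} → IsWalk G L w → IsWalkℕ L (extend w)
  walk⇒walkℕ {L} {w} W k k<L =
    subst₂ Adj (vertexAt (inject₁ i) (trans (toℕ-inject₁ i) (toℕ-fromℕ< k<L)))
               (vertexAt (Fin.suc i) (cong suc (toℕ-fromℕ< k<L)))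
               (W i)
    where
      i : Fin L
      i = fromℕ< k<L
      vertexAt : ∀ t {n} → toℕ t ≡ n → w t ≡ extend w n
      vertexAt t refl = sym (extend-toℕ w t)

  walkℕ⇒walk : ∀ {L g} → IsWalkℕ L g → IsWalk G L (g ∘ toℕ)
  walkℕ⇒walk {g = g} W i =
    subst (λ n → Adj (g n) (g (suc (toℕ i)))) (sym (toℕ-inject₁ i)) (W (toℕ i) (toℕ<n i))

  shortcut : ℕ → ℕ → (ℕ → V G) → ℕ → V G
  shortcut a s g k with k ≤? a
  ... | yes _ = g k
  ... | no _  = g (k + s)

  module _ {a s : ℕ} {g : ℕ → V G} where

    shortcut-≤ : ∀ {k} → k ≤ a → shortcut a s g k ≡ g k
    shortcut-≤ {k} k≤a with k ≤? a
    ... | yes _  = refl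
    ... | no k≰a = ⊥-elim (k≰a k≤a)

    shortcut-> : ∀ {k} → a < k → shortcut a s g k ≡ g (k + s)
    shortcut-> {k} a<k with k ≤? a
    ... | yes k≤a = ⊥-elim (<⇒≱ a<k k≤a)
    ... | no _    = refl

    shift : ∀ {k r} → k < a + r → k + s < a + s + r
    shift {k} {r} k<a+r = subst (k + s <_) (xy∙z≈xz∙y a r s) (+-monoˡ-< s k<a+r)

    shortcut-walk : ∀ {r} → IsWalkℕ (a + s + r) g → g a ≡ g (a + s) →
                    IsWalkℕ (a + r) (shortcut a s g)
    shortcut-walk {r} W loop k k<a+r with ℕ.<-cmp k a
    ... | tri< k<a _ _ =
      subst₂ Adj (sym (shortcut-≤ (<⇒≤ k<a))) (sym (shortcut-≤ k<a))
                 (W k (≤-<-trans (m≤m+n k s) (shift k<a+r)))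
    ... | tri≈ _ refl _ =
      subst₂ Adj (sym (trans (shortcut-≤ ≤-refl) loop)) (sym (shortcut-> (n<1+n a)))
                 (W (a + s) (shift k<a+r))
    ... | tri> _ _ a<k =
      subst₂ Adj (sym (shortcut-> a<k)) (sym (shortcut-> (m<n⇒m<1+n a<k)))
                 (W (k + s) (shift k<a+r))

    shortcut-end : ∀ r → g a ≡ g (a + s) → shortcut a s g (a + r) ≡ g (a + s + r)
    shortcut-end zero loop = begin
      shortcut a s g (a + 0) ≡⟨ shortcut-≤ (≤-reflexive (+-identityʳ a)) ⟩
      g (a + 0)              ≡⟨ cong g (+-identityʳ a) ⟩
      g a                    ≡⟨ loop ⟩
      g (a + s)              ≡⟨ cong g (+-identityʳ (a + s)) ⟨
      g (a + s + 0)          ∎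
      where open ≡-Reasoning
    shortcut-end (suc r) _ =
      trans (shortcut-> (m<m+n a z<s)) (cong g (xy∙z≈xz∙y a (suc r) s))

  repeat⇒shorterWalkℕ : ∀ {L g a b} → IsWalkℕ L g → a < b → b ≤ L → g a ≡ g b →
    ∃ λ L' → L' < L × Σ (ℕ → V G) λ g' → IsWalkℕ L' g' × g' 0 ≡ g 0 × g' L' ≡ g L
  repeat⇒shorterWalkℕ {g = g} {a} W a<b b≤L loop
    with m≤n⇒∃[o]m+o≡n (<⇒≤ a<b) | m≤n⇒∃[o]m+o≡n b≤L
  ... | s , refl | r , refl =
    a + r , +-monoˡ-< r a<b , shortcut a s g ,
    shortcut-walk W loop , shortcut-≤ {a} {s} {g} z≤n , shortcut-end {a} {s} {g} r loop

  NoShorterWalk : (L : ℕ) → (Fin (suc L) → V G) → Set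
  NoShorterWalk L p =
    ∀ L' w → IsWalk G L' w → w Fin.zero ≡ p Fin.zero → w (fromℕ L') ≡ p (fromℕ L) → L ≤ L'

  noShorterWalk⇒injective : ∀ {L w} → IsWalk G L w → NoShorterWalk L w → Injective _≡_ _≡_ w
  noShorterWalk⇒injective {L} {w} W noShorter = <-distinct⇒injective w noRepeat
    where
      noRepeat : ∀ {i j} → i Fin.< j → w i ≡ w j → ⊥
      noRepeat {i} {j} i<j wi≡wj
        with repeat⇒shorterWalkℕ (walk⇒walkℕ W) i<j (toℕ≤pred[n] j)
               (trans (extend-toℕ w i) (trans wi≡wj (sym (extend-toℕ w j))))
      ... | L' , L'<L , g' , W' , start , end =
        <⇒≱ L'<L (noShorter L' (g' ∘ toℕ) (walkℕ⇒walk W')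
                   (trans start (extend-toℕ w Fin.zero))
                   (trans (cong g' (toℕ-fromℕ L')) (trans end (extend-fromℕ w))))

  dist⇒shortestPath : ∀ {u v D} → IsDist G u v D → Σ (Fin (suc D) → V G) (IsShortestPath G D)
  dist⇒shortestPath ((w , W , w₀≡u , wD≡v) , minimal) =
    w , (W , noShorterWalk⇒injective W noShorter) , noShorter
    where
      noShorter : NoShorterWalk _ w
      noShorter L' w' W' start end = minimal L' w' W' (trans start w₀≡u) (trans end wD≡v)

  colouring⇒⌈/2⌉≤ : ∀ {D χ} (p : Fin (suc D) → V G) (c : V G → Fin χ) →
                    (∀ a → ¬ HasThreeIn G (λ x → c x ≡ a) D p) → ⌈ suc D /2⌉ ≤ χ
  colouring⇒⌈/2⌉≤ p c noThree = atMostTwoToOne⇒⌈/2⌉≤ (c ∘ p)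
    λ {i} {j} {l} i<j j<l ci≡cj cj≡cl →
      noThree (c (p j)) (i , j , l , i<j , j<l , ci≡cj , refl , sym cj≡cl)

mainTheorem6 : (G : Graph) →
    (∀ (χ D : ℕ) → IsChiGP G χ → IsDiamStar G D → ⌈ suc D /2⌉ ≤ χ) ×
    (∀ (χ D : ℕ) → IsChiMP G χ → IsMonoDiamStar G D → ⌈ suc D /2⌉ ≤ χ)
mainTheorem6 G = gpBound , mpBound
  where
    gpBound : ∀ (χ D : ℕ) → IsChiGP G χ → IsDiamStar G D → ⌈ suc D /2⌉ ≤ χ
    gpBound χ D ((c , gpClasses) , _) ((_ , _ , dist) , _) =
      let (p , shortest) = dist⇒shortestPath G dist
      in colouring⇒⌈/2⌉≤ G p c (λ a → gpClasses a D p shortest)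

    mpBound : ∀ (χ D : ℕ) → IsChiMP G χ → IsMonoDiamStar G D → ⌈ suc D /2⌉ ≤ χ
    mpBound χ D ((c , mpClasses) , _) ((p , induced) , _) =
      colouring⇒⌈/2⌉≤ G p c (λ a → mpClasses a D p induced)
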